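{- Let $G$ be a doubly homogeneously traceable graph of order $n$ and circumference $c$, and let $v$ be a vertex of degree $3$ in $G$. Let $G'$ be the graph obtained from $G$ by blowing up $v$ into $K_3$. Then $G'$ is also doubly homogeneously traceable. If moreover $v$ lies in a longest cycle of $G$, then $G'$ has circumference $c+2$.
   Context: All graphs are finite and simple. For a vertex $v$, a $v$-path is a path with $v$ as an endpoint. A graph $G$ is doubly homogeneously traceable if for every vertex $v$ of $G$ there are two Hamilton $v$-paths $P$ and $Q$ such that the edge of $P$ incident to $v$ and the edge of $Q$ incident to $v$ are distinct. The circumference of a graph is the length of a longest cycle. If $v$ is a vertex of degree $d$ with neighborhood $N(v)$, blowing up $v$ into the complete graph $K_d$ means deleting $v$, adding a new complete graph on $d$ new vertices, and adding $d$ edges joining the vertices of this $K_d$ to the vertices of $N(v)$ so that these $d$ new edges form a matching (each new vertex joined to exactly one vertex of $N(v)$ and vice versa). -}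

module Defs where

open import Data.Nat using (ℕ; _≤_; _+_)
open import Data.Fin using (Fin; zero; suc)
open import Data.List using (List; []; _∷_; length; last)
open import Data.List.Relation.Unary.Unique.Propositional using (Unique)
open import Data.List.Relation.Unary.Linked using (Linked)
open import Data.List.Membership.Propositional using (_∈_)
open import Data.Maybe using (Maybe; just; nothing)
open import Data.Product using (Σ; ∃; ∃-syntax; _×_; _,_; proj₁)
open import Data.Sum using (_⊎_; inj₁; inj₂)
open import Data.Empty using (⊥)
open import Data.Unit using (⊤; tt)
open import Relation.Nullary using (¬_; Dec; yes; no)
open import Relation.Nullary.Decidable using (False)
open import Relation.Binary.Definitions using (DecidableEquality)
open import Relation.Binary.PropositionalEquality using (_≡_; _≢_; refl; sym; cong)

record Graph : Set₁ where
  field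
    V      : Set
    _≟_    : DecidableEquality V
    Adj    : V → V → Set
    symAdj : ∀ {x y} → Adj x y → Adj y x
    irrAdj : ∀ {x} → ¬ Adj x x

open Graph public

module _ (G : Graph) where

  IsPath : List (V G) → Set
  IsPath xs = Unique xs × Linked (Adj G) xs

  IsHamPath : List (V G) → Set
  IsHamPath xs = IsPath xs × (∀ x → x ∈ xs)

  DoublyHomTraceable : Set
  DoublyHomTraceable =
    ∀ v → ∃[ w₁ ] ∃[ w₂ ] ∃[ r₁ ] ∃[ r₂ ]
      (w₁ ≢ w₂ × IsHamPath (v ∷ w₁ ∷ r₁) × IsHamPath (v ∷ w₂ ∷ r₂))

  Closes : List (V G) → Set
  Closes []       = ⊥
  Closes (x ∷ xs) = LastAdj xs
    where
    LastAdj : List (V G) → Set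
    LastAdj []       = ⊥
    LastAdj (y ∷ []) = Adj G y x
    LastAdj (y ∷ z ∷ zs) = LastAdj (z ∷ zs)

  IsCycle : List (V G) → Set
  IsCycle xs = 3 ≤ length xs × IsPath xs × Closes xs

  IsCircumference : ℕ → Set
  IsCircumference c =
    (∃[ xs ] (IsCycle xs × length xs ≡ c)) × (∀ xs → IsCycle xs → length xs ≤ c)

  Degree3Nbhd : V G → V G → V G → V G → Set
  Degree3Nbhd v a b d =
    a ≢ b × a ≢ d × b ≢ d × Adj G v a × Adj G v b × Adj G v d ×
    (∀ u → Adj G v u → u ≡ a ⊎ u ≡ b ⊎ u ≡ d)

  OnLongestCycle : ℕ → V G → Set
  OnLongestCycle c v = ∃[ xs ] (IsCycle xs × length xs ≡ c × v ∈ xs)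

private
  False-irr : ∀ {P : Set} (d : Dec P) (p q : False d) → p ≡ q
  False-irr (yes _) () _
  False-irr (no _) tt tt = refl

-- Blowing up v into K₃: delete v, add new vertices 0,1,2 forming a triangle,
-- with new vertex 0,1,2 joined to a,b,d respectively (a matching onto N(v)).
blowUp : (G : Graph) → (v a b d : V G) → Graph
blowUp G v a b d = record
  { V = V'
  ; _≟_ = eq
  ; Adj = E
  ; symAdj = λ {x} {y} → s x y
  ; irrAdj = λ {x} → ir x
  }
  where
  _≟G_ = _≟_ G
  Old = Σ (V G) (λ u → False (u ≟G v))
  V' = Old ⊎ Fin 3

  nb : Fin 3 → V G
  nb zero = a
  nb (suc zero) = b
  nb (suc (suc zero)) = d

  eq : DecidableEquality V'
  eq (inj₁ (x , p)) y = go y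
    where
    go : ∀ y → Dec (inj₁ (x , p) ≡ y)
    go (inj₂ _) = no (λ ())
    go (inj₁ (y , q)) with x ≟G y
    ... | yes refl = yes (cong (λ r → inj₁ (x , r)) (False-irr (x ≟G v) p q))
    go (inj₁ (y , q)) | no x≢y = no (λ { refl → x≢y refl })
  eq (inj₂ i) (inj₁ _) = no (λ ())
  eq (inj₂ i) (inj₂ j) with i Data.Fin.≟ j
  ... | yes refl = yes refl
  ... | no i≢j = no (λ { refl → i≢j refl })

  E : V' → V' → Set
  E (inj₁ (x , _)) (inj₁ (y , _)) = Adj G x y
  E (inj₁ (x , _)) (inj₂ i) = x ≡ nb i
  E (inj₂ i) (inj₁ (y , _)) = y ≡ nb i
  E (inj₂ i) (inj₂ j) = i ≢ j

  s : ∀ x y → E x y → E y x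
  s (inj₁ _) (inj₁ _) e = symAdj G e
  s (inj₁ _) (inj₂ _) e = e
  s (inj₂ _) (inj₁ _) e = e
  s (inj₂ _) (inj₂ _) e = λ j≡i → e (sym j≡i)

  ir : ∀ x → ¬ E x x
  ir (inj₁ _) = irrAdj G
  ir (inj₂ _) e = e refl

-- A path through v enters and leaves v through two distinct neighbours nb t and
-- nb j; replacing v by the walk t, third t j, j through the triangle yields a path
-- of the blow-up G' with the same old vertices and all three new ones.  Applied to
-- Hamilton x-paths this serves every old vertex x, and the first edges stay distinct
-- because contracting the triangle back to v recovers them.  A triangle vertex e
-- gets a Hamilton path e, third e j, j, … from a Hamilton v-path whose first edge
-- avoids nb e, and a Hamilton path e, nb e, … from a Hamilton (nb e)-path whose first
-- edge avoids v, crossing the triangle as i, third e i.  The same replacement turns a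
-- longest cycle through v into a cycle of length c + 2.  Conversely, a triangle
-- vertex has only one old neighbour, so the triangle vertices on a cycle of G' form
-- a single run of at most three vertices; contracting it to v gives a cycle of G, so
-- no cycle of G' is longer than c + 2.

module Submission where

open import Defs
open import Data.Nat using (ℕ; suc; _+_; _≤_; z≤n; s≤s)
open import Data.Nat.Properties
  using (+-comm; +-identityʳ; m≤m+n; n≤1+n; +-monoˡ-≤; +-monoʳ-≤; module ≤-Reasoning)
open import Data.Fin as Fin using (Fin; zero; suc)
open import Data.Fin.Properties using (all?)
open import Function.Bundles using (_↔_)
open import Data.Maybe using (just)
import Data.Maybe.Relation.Unary.All as Maybe
open import Data.Maybe.Relation.Binary.Connected using (Connected; just; just-nothing; nothing-just; nothing)
open import Data.Product using (Σ; ∃; ∃₂; _×_; _,_; proj₁; proj₂)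
open import Data.Sum using (_⊎_; inj₁; inj₂; swap)
open import Data.Sum.Properties using (inj₁-injective; inj₂-injective)
open import Data.Empty using (⊥-elim)
open import Data.Unit using (tt)
open import Data.Bool.Properties using (T-irrelevant)
open import Data.List using (List; []; _∷_; _++_; [_]; _∷ʳ_; length; map; last; head; initLast; _∷ʳ′_)
open import Data.List.Properties
  using (length-++; length-map; map-++; ++-assoc; ++-identityʳ; ∷-injective; ∷-injectiveˡ)
open import Data.List.Relation.Unary.All as All using (All; []; _∷_)
import Data.List.Relation.Unary.All.Properties as All
open import Data.List.Relation.Unary.Any using (Any; here; there)
open import Data.List.Relation.Unary.AllPairs using ([]; _∷_)
open import Data.List.Relation.Unary.Linked as Linked using (Linked; []; [-]; _∷_)
import Data.List.Relation.Unary.Linked.Properties as Linked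
open import Data.List.Relation.Unary.Unique.Propositional using (Unique)
import Data.List.Relation.Unary.Unique.Propositional.Properties as Unique
open import Data.List.Relation.Unary.Unique.DecPropositional using (unique?)
open import Data.List.Relation.Binary.Disjoint.Propositional using (Disjoint)
open import Data.List.Membership.Propositional using (_∈_; _∉_; find)
open import Data.List.Membership.Propositional.Properties
  using (∈-++⁺ˡ; ∈-++⁺ʳ; ∈-++⁻; ∈-map⁺; ∈-map⁻; ∈-∃++)
open import Relation.Nullary using (¬_; ¬?; yes; no)
open import Function using (_∘_)
open import Relation.Nullary.Decidable
  using (False; fromWitnessFalse; toWitnessFalse; toWitness; _→-dec_; _×-dec_)
open import Relation.Binary.PropositionalEquality
  using (_≡_; _≢_; refl; sym; trans; cong; subst; ≢-sym; module ≡-Reasoning)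

module _ {A : Set} where

  Linked-++⁻ : ∀ {R : A → A → Set} xs {ys} → Linked R (xs ++ ys) →
               Linked R xs × Connected R (last xs) (head ys) × Linked R ys
  Linked-++⁻ []             {[]}     l       = [] , nothing , l
  Linked-++⁻ []             {_ ∷ _}  l       = [] , nothing-just , l
  Linked-++⁻ (_ ∷ [])       {[]}     _       = [-] , just-nothing , []
  Linked-++⁻ (_ ∷ [])       {_ ∷ _}  (r ∷ l) = [-] , just r , l
  Linked-++⁻ (_ ∷ x ∷ xs)            (r ∷ l) with Linked-++⁻ (x ∷ xs) l
  ... | lxs , c , lys = r ∷ lxs , c , lys

  Unique-++⁻ : ∀ xs {ys : List A} → Unique (xs ++ ys) → Unique xs × Unique ys × Disjoint xs ys
  Unique-++⁻ []       u         = [] , u , λ ()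
  Unique-++⁻ (x ∷ xs) (x∉ ∷ u) with Unique-++⁻ xs u
  ... | uxs , uys , dis = All.++⁻ˡ xs x∉ ∷ uxs , uys , λ
    { (here refl , y∈ys) → All.lookup (All.++⁻ʳ xs x∉) y∈ys refl
    ; (there y∈xs , y∈ys) → dis (y∈xs , y∈ys) }

  Unique-++⇒≢ : ∀ xs {ys : List A} {x y} → Unique (xs ++ ys) → x ∈ xs → y ∈ ys → x ≢ y
  Unique-++⇒≢ xs u x∈xs y∈ys refl = proj₂ (proj₂ (Unique-++⁻ xs u)) (x∈xs , y∈ys)

  last-++ : ∀ xs {y : A} {ys} → last (xs ++ y ∷ ys) ≡ last (y ∷ ys)
  last-++ []           = refl
  last-++ (_ ∷ [])     = refl
  last-++ (_ ∷ x ∷ xs) = last-++ (x ∷ xs)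

  length-++-comm : ∀ (xs ys : List A) → length (xs ++ ys) ≡ length (ys ++ xs)
  length-++-comm xs ys = trans (length-++ xs) (trans (+-comm (length xs) _) (sym (length-++ ys)))

  split-at-predecessor : ∀ x xs {y : A} → y ∈ xs → ∃₂ λ α p → ∃ λ β → x ∷ xs ≡ α ++ p ∷ y ∷ β
  split-at-predecessor x (_ ∷ xs) (here refl) = [] , x , xs , refl
  split-at-predecessor x (z ∷ xs) (there y∈xs) with split-at-predecessor z xs y∈xs
  ... | α , p , β , eq = x ∷ α , p , β , cong (x ∷_) eq

  all-or-any : ∀ {P Q : A → Set} → (∀ x → P x ⊎ Q x) → ∀ xs → All P xs ⊎ Any Q xs
  all-or-any pq [] = inj₁ []
  all-or-any pq (x ∷ xs) with pq x | all-or-any pq xs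
  ... | inj₂ qx | _        = inj₂ (here qx)
  ... | inj₁ _  | inj₂ any = inj₂ (there any)
  ... | inj₁ px | inj₁ all = inj₁ (px ∷ all)

  first-transition : ∀ {P Q : A → Set} → (∀ x → P x ⊎ Q x) → ∀ {x} xs → P x → Any Q xs →
    ∃₂ λ π p → ∃₂ λ q κ → x ∷ xs ≡ π ++ p ∷ q ∷ κ × P p × Q q
  first-transition pq (y ∷ xs) px (here qy) = [] , _ , y , xs , refl , px , qy
  first-transition pq {x} (y ∷ xs) px (there any) with pq y
  ... | inj₂ qy = [] , x , y , xs , refl , px , qy
  ... | inj₁ py with first-transition pq xs py any
  ...   | π , p , q , κ , eq , pp , qq = x ∷ π , p , q , κ , cong (x ∷_) eq , pp , qq

  span : ∀ {P Q : A → Set} → (∀ x → P x ⊎ Q x) → ∀ xs →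
    ∃₂ λ ys zs → xs ≡ ys ++ zs × All P ys × Maybe.All Q (head zs)
  span pq []       = [] , [] , refl , [] , Maybe.nothing
  span pq (x ∷ xs) with pq x
  ... | inj₂ qx = [] , x ∷ xs , refl , [] , Maybe.just qx
  ... | inj₁ px with span pq xs
  ...   | ys , zs , eq , pys , qzs = x ∷ ys , zs , cong (x ∷_) eq , px ∷ pys , qzs

  All-image⇒map : ∀ {B : Set} {f : B → A} {xs} →
                  All (λ x → ∃ λ y → x ≡ f y) xs → ∃ λ ys → xs ≡ map f ys
  All-image⇒map []                  = [] , refl
  All-image⇒map ((y , refl) ∷ imgs) with All-image⇒map imgs
  ... | ys , refl = y ∷ ys , refl

module _ (H : Graph) where

  IsPath-++⁺ : ∀ {xs ys} → IsPath H xs → IsPath H ys → Disjoint xs ys →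
               Connected (Adj H) (last xs) (head ys) → IsPath H (xs ++ ys)
  IsPath-++⁺ (uxs , lxs) (uys , lys) dis c = Unique.++⁺ uxs uys dis , Linked.++⁺ lxs c lys

  IsPath-++⁻ : ∀ xs {ys} → IsPath H (xs ++ ys) →
               IsPath H xs × IsPath H ys × Disjoint xs ys × Connected (Adj H) (last xs) (head ys)
  IsPath-++⁻ xs (u , l) with Unique-++⁻ xs u | Linked-++⁻ xs l
  ... | uxs , uys , dis | lxs , c , lys = (uxs , lxs) , (uys , lys) , dis , c

  IsPath-∷⁺ : ∀ {x xs} → x ∉ xs → Connected (Adj H) (just x) (head xs) → IsPath H xs → IsPath H (x ∷ xs)
  IsPath-∷⁺ x∉xs c (u , l) = All.¬Any⇒All¬ _ x∉xs ∷ u , c Linked.∷′ l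

  IsPath-∷⁻ : ∀ {x xs} → IsPath H (x ∷ xs) → x ∉ xs × IsPath H xs
  IsPath-∷⁻ (x∉ ∷ u , l) = All.All¬⇒¬Any x∉ , u , Linked.tail l

  Closes⇒Connected : ∀ x xs → Closes H (x ∷ xs) → Connected (Adj H) (last (x ∷ xs)) (just x)
  Closes⇒Connected x (y ∷ [])     e = just e
  Closes⇒Connected x (y ∷ z ∷ zs) e = Closes⇒Connected x (z ∷ zs) e

  Connected⇒Closes : ∀ x xs → Connected (Adj H) (last (x ∷ xs)) (just x) → Closes H (x ∷ xs)
  Connected⇒Closes x []           (just e) = irrAdj H e
  Connected⇒Closes x (y ∷ [])     (just e) = e
  Connected⇒Closes x (y ∷ z ∷ zs) c        = Connected⇒Closes x (z ∷ zs) c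

  rotate-cycle : ∀ xs ys → IsCycle H (xs ++ ys) → IsCycle H (ys ++ xs)
  rotate-cycle []       ys cyc = subst (IsCycle H) (sym (++-identityʳ ys)) cyc
  rotate-cycle (x ∷ xs) [] cyc = subst (IsCycle H) (++-identityʳ (x ∷ xs)) cyc
  rotate-cycle (x ∷ xs) (y ∷ ys) (3≤ , path , closes)
    with IsPath-++⁻ (x ∷ xs) path
  ... | pxs , pys , dis , x⋯→y =
    subst (3 ≤_) (length-++-comm (x ∷ xs) (y ∷ ys)) 3≤ ,
    IsPath-++⁺ pys pxs (λ (p , q) → dis (q , p)) y⋯→x ,
    Connected⇒Closes y (ys ++ x ∷ xs)
      (subst (λ l → Connected (Adj H) l (just y)) (sym (last-++ (y ∷ ys))) x⋯→y)
    where
    y⋯→x : Connected (Adj H) (last (y ∷ ys)) (just x)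
    y⋯→x = subst (λ l → Connected (Adj H) l (just x)) (last-++ (x ∷ xs))
             (Closes⇒Connected x (xs ++ y ∷ ys) closes)

  rotate-cut : ∀ α x y β → IsCycle H (α ++ x ∷ y ∷ β) → IsCycle H (y ∷ (β ++ α) ++ [ x ])
  rotate-cut α x y β cyc =
    subst (λ l → IsCycle H (y ∷ l)) (sym (++-assoc β α [ x ]))
      (rotate-cycle (α ∷ʳ x) (y ∷ β) (subst (IsCycle H) (sym (++-assoc α [ x ] (y ∷ β))) cyc))

  length-rotate-cut : ∀ α x y (β : List (V H)) →
                      length (y ∷ (β ++ α) ++ [ x ]) ≡ length (α ++ x ∷ y ∷ β)
  length-rotate-cut α x y β = begin
    length (y ∷ (β ++ α) ++ [ x ])  ≡⟨ cong (suc ∘ length) (++-assoc β α [ x ]) ⟩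
    length ((y ∷ β) ++ α ∷ʳ x)      ≡⟨ length-++-comm (y ∷ β) (α ∷ʳ x) ⟩
    length ((α ∷ʳ x) ++ y ∷ β)      ≡⟨ cong length (++-assoc α [ x ] (y ∷ β)) ⟩
    length (α ++ x ∷ y ∷ β)         ∎
    where open ≡-Reasoning

  rotate-to-front : ∀ {xs x} → IsCycle H xs → x ∈ xs →
                    ∃ λ ys → IsCycle H (x ∷ ys) × length xs ≡ suc (length ys)
  rotate-to-front cyc x∈xs with ∈-∃++ x∈xs
  ... | α , β , refl = β ++ α , rotate-cycle α (_ ∷ β) cyc , length-++-comm α (_ ∷ β)

  rotate-around : ∀ {xs x} → IsCycle H xs → x ∈ xs →
    ∃₂ λ p y → ∃ λ γ → IsCycle H (p ∷ x ∷ y ∷ γ) × length xs ≡ 3 + length γ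
  rotate-around {x = x} cyc x∈xs with rotate-to-front cyc x∈xs
  ... | ys , cyc′ , len with initLast ys | cyc′
  ... | []        | (s≤s () , _)
  ... | ys′ ∷ʳ′ p | _ with ys′ | rotate-cycle (x ∷ ys′) [ p ] cyc′
  ...   | []    | (s≤s (s≤s ()) , _)
  ...   | y ∷ γ | cyc″ =
    p , y , γ , cyc″ , trans len (cong (λ n → suc (suc n)) (trans (length-++ γ) (+-comm (length γ) 1)))

  ham-path-avoiding : DoublyHomTraceable H → ∀ x z → ∃₂ λ w r → w ≢ z × IsHamPath H (x ∷ w ∷ r)
  ham-path-avoiding dht x z with dht x
  ... | w₁ , w₂ , r₁ , r₂ , w₁≢w₂ , ham₁ , ham₂ with _≟_ H w₁ z
  ... | yes refl = w₂ , r₂ , ≢-sym w₁≢w₂ , ham₂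
  ... | no w₁≢z  = w₁ , r₁ , w₁≢z , ham₁

-- The last clause only covers i ≡ j, where third i j is junk.
third : Fin 3 → Fin 3 → Fin 3
third zero             (suc zero)       = suc (suc zero)
third zero             (suc (suc zero)) = suc zero
third (suc zero)       zero             = suc (suc zero)
third (suc zero)       (suc (suc zero)) = zero
third (suc (suc zero)) zero             = suc zero
third (suc (suc zero)) (suc zero)       = zero
third i                _                = i

third-≢ : ∀ i j → i ≢ j → third i j ≢ i × third i j ≢ j
third-≢ = toWitness {a? = all? λ i → all? λ j →
  ¬? (i Fin.≟ j) →-dec (¬? (third i j Fin.≟ i) ×-dec ¬? (third i j Fin.≟ j))} tt

third-unique : ∀ i j k → i ≢ j → k ≢ i → k ≢ j → k ≡ third i j
third-unique = toWitness {a? = all? λ i → all? λ j → all? λ k →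
  ¬? (i Fin.≟ j) →-dec ¬? (k Fin.≟ i) →-dec ¬? (k Fin.≟ j) →-dec k Fin.≟ third i j} tt

triangle : Fin 3 → Fin 3 → List (Fin 3)
triangle i j = i ∷ third i j ∷ j ∷ []

triangle-unique : ∀ {i j} → i ≢ j → Unique (triangle i j)
triangle-unique {i} {j} i≢j with third-≢ i j i≢j
... | t≢i , t≢j = (≢-sym t≢i ∷ i≢j ∷ []) ∷ (t≢j ∷ []) ∷ [] ∷ []

triangle-covers : ∀ {i j} → i ≢ j → ∀ k → k ∈ triangle i j
triangle-covers {i} {j} i≢j k with k Fin.≟ i | k Fin.≟ j
... | yes refl | _        = here refl
... | no _     | yes refl = there (there (here refl))
... | no k≢i   | no k≢j   = there (here (third-unique i j k i≢j k≢i k≢j))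

other : Fin 3 → Fin 3
other zero    = suc zero
other (suc _) = zero

other-≢ : ∀ i → i ≢ other i
other-≢ zero    ()
other-≢ (suc _) ()

four-not-unique : ∀ (i j k l : Fin 3) → ¬ Unique (i ∷ j ∷ k ∷ l ∷ [])
four-not-unique = toWitness {a? = all? λ i → all? λ j → all? λ k → all? λ l →
  ¬? (unique? Fin._≟_ (i ∷ j ∷ k ∷ l ∷ []))} tt

Unique⇒length≤3 : ∀ {is : List (Fin 3)} → Unique is → length is ≤ 3
Unique⇒length≤3 {[]}                  _ = z≤n
Unique⇒length≤3 {_ ∷ []}              _ = s≤s z≤n
Unique⇒length≤3 {_ ∷ _ ∷ []}          _ = s≤s (s≤s z≤n)
Unique⇒length≤3 {_ ∷ _ ∷ _ ∷ []}      _ = s≤s (s≤s (s≤s z≤n))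
Unique⇒length≤3 {i ∷ j ∷ k ∷ l ∷ _} u = ⊥-elim (four-not-unique i j k l (Unique.take⁺ 4 u))

module BlowUp (G : Graph) (v a b d : V G)
              (v~a : Adj G v a) (v~b : Adj G v b) (v~d : Adj G v d)
              (N[v] : ∀ u → Adj G v u → u ≡ a ⊎ u ≡ b ⊎ u ≡ d) where

  G' : Graph
  G' = blowUp G v a b d

  -- The vertex type of G' computes to Old ⊎ Fin 3.
  Old : Set
  Old = Σ (V G) λ x → False (_≟_ G x v)

  old : Old → V G'
  old = inj₁

  new : Fin 3 → V G'
  new = inj₂

  -- Numbered as in blowUp: new vertex i is joined to nb i.
  nb : Fin 3 → V G
  nb zero             = a
  nb (suc zero)       = b
  nb (suc (suc zero)) = d

  down : V G' → V G
  down (inj₁ x) = proj₁ x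
  down (inj₂ _) = v

  IsOld IsNew : V G' → Set
  IsOld s = ∃ λ x → s ≡ old x
  IsNew s = ∃ λ i → s ≡ new i

  old-or-new : ∀ s → IsOld s ⊎ IsNew s
  old-or-new (inj₁ x) = inj₁ (x , refl)
  old-or-new (inj₂ i) = inj₂ (i , refl)

  toOld : ∀ {x} → x ≢ v → Old
  toOld x≢v = _ , fromWitnessFalse x≢v

  Old-≡ : ∀ {x y : Old} → proj₁ x ≡ proj₁ y → x ≡ y
  Old-≡ {x , p} {.x , q} refl = cong (x ,_) (T-irrelevant p q)

  Old≢v : ∀ (x : Old) → proj₁ x ≢ v
  Old≢v x = toWitnessFalse (proj₂ x)

  v∉Olds : ∀ (xs : List Old) → v ∉ map proj₁ xs
  v∉Olds (x ∷ _)  (here v≡x) = Old≢v x (sym v≡x)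
  v∉Olds (_ ∷ xs) (there m)  = v∉Olds xs m

  v∉⇒Olds : ∀ xs → v ∉ xs → ∃ λ ys → xs ≡ map proj₁ ys
  v∉⇒Olds xs v∉xs = All-image⇒map (All.tabulate λ x∈xs → toOld (λ { refl → v∉xs x∈xs }) , refl)

  length-lift : ∀ (xs : List Old) → length (map old xs) ≡ length (map proj₁ xs)
  length-lift xs = trans (length-map old xs) (sym (length-map proj₁ xs))

  through : List Old → Old → List Old → List (V G)
  through α p β = map proj₁ α ++ proj₁ p ∷ v ∷ map proj₁ β

  spliced : List Old → Old → List (Fin 3) → List Old → List (V G')
  spliced α p is β = map old α ++ old p ∷ map new is ++ map old β

  v~nb : ∀ i → Adj G v (nb i)
  v~nb zero             = v~a
  v~nb (suc zero)       = v~b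
  v~nb (suc (suc zero)) = v~d

  nb-index : ∀ {u} → Adj G v u → ∃ λ i → u ≡ nb i
  nb-index {u} v~u with N[v] u v~u
  ... | inj₁ u≡a        = zero , u≡a
  ... | inj₂ (inj₁ u≡b) = suc zero , u≡b
  ... | inj₂ (inj₂ u≡d) = suc (suc zero) , u≡d

  old~new⇒ : ∀ {x} i → Adj G' (old x) (new i) → proj₁ x ≡ nb i
  old~new⇒ zero             e = e
  old~new⇒ (suc zero)       e = e
  old~new⇒ (suc (suc zero)) e = e

  old~new⇐ : ∀ {x} i → proj₁ x ≡ nb i → Adj G' (old x) (new i)
  old~new⇐ zero             e = e
  old~new⇐ (suc zero)       e = e
  old~new⇐ (suc (suc zero)) e = e

  new~old⇐ : ∀ {x} i → proj₁ x ≡ nb i → Adj G' (new i) (old x)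
  new~old⇐ {x} i e = symAdj G' {old x} {new i} (old~new⇐ {x} i e)

  contract-edge : ∀ {x} s → Adj G' (old x) s → Adj G (proj₁ x) (down s)
  contract-edge (inj₁ _) e = e
  contract-edge {x} (inj₂ i) e = symAdj G (subst (Adj G v) (sym (old~new⇒ {x} i e)) (v~nb i))

  new-has-one-old-neighbour : ∀ {x y} i → Adj G' (old x) (new i) → Adj G' (new i) (old y) → x ≡ y
  new-has-one-old-neighbour {x} {y} i x~i i~y =
    Old-≡ (trans (old~new⇒ {x} i x~i) (sym (old~new⇒ {y} i (symAdj G' {new i} {old y} i~y))))

  old-∈⁻ : ∀ {x xs} → old x ∈ map old xs → proj₁ x ∈ map proj₁ xs
  old-∈⁻ {xs = _ ∷ _} (here refl) = here refl
  old-∈⁻ {xs = _ ∷ _} (there m)   = there (old-∈⁻ m)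

  old-∈⁺ : ∀ {x xs} → proj₁ x ∈ map proj₁ xs → old x ∈ map old xs
  old-∈⁺ {xs = _ ∷ _} (here e)  = here (cong old (Old-≡ e))
  old-∈⁺ {xs = _ ∷ _} (there m) = there (old-∈⁺ m)

  old∉new : ∀ {x is} → old x ∉ map new is
  old∉new {is = _ ∷ _} (there m) = old∉new m

  new∉old : ∀ {i xs} → new i ∉ map old xs
  new∉old {xs = _ ∷ _} (there m) = new∉old m

  lift-path : ∀ {xs} → IsPath G (map proj₁ xs) → IsPath G' (map old xs)
  lift-path (u , l) = Unique.map⁺ inj₁-injective (Unique.map⁻ u) , Linked.map⁺ (Linked.map⁻ l)

  contract-path : ∀ {xs} → IsPath G' (map old xs) → IsPath G (map proj₁ xs)
  contract-path (u , l) = Unique.map⁺ Old-≡ (Unique.map⁻ u) , Linked.map⁺ (Linked.map⁻ l)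

  triangle-path : ∀ {is} → Unique is → IsPath G' (map new is)
  triangle-path u = Unique.map⁺ inj₂-injective u , Linked.map⁺ (Linked.AllPairs⇒Linked u)

  lift-last : ∀ xs {y} → Connected (Adj G) (last (map proj₁ xs)) (just (proj₁ y)) →
              Connected (Adj G') (last (map old xs)) (just (old y))
  lift-last []           _        = nothing-just
  lift-last (_ ∷ [])     (just e) = just e
  lift-last (_ ∷ x ∷ xs) c        = lift-last (x ∷ xs) c

  contract-last : ∀ xs {s} → Connected (Adj G') (last (map old xs)) (just s) →
                  Connected (Adj G) (last (map proj₁ xs)) (just (down s))
  contract-last []           _        = nothing-just
  contract-last (x ∷ [])  {s} (just e) = just (contract-edge {x} s e)
  contract-last (_ ∷ x ∷ xs) c        = contract-last (x ∷ xs) c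

  new-old-disjoint : ∀ {is xs} → Disjoint (map new is) (map old xs)
  new-old-disjoint (m₁ , m₂) with ∈-map⁻ new m₁
  ... | _ , _ , refl = new∉old m₂

  splice-at-start : ∀ β {is} → IsPath G (v ∷ map proj₁ β) → Unique is →
    Connected (Adj G') (last (map new is)) (head (map old β)) → IsPath G' (map new is ++ map old β)
  splice-at-start β path u c =
    IsPath-++⁺ G' (triangle-path u) (lift-path (proj₂ (IsPath-∷⁻ G path))) new-old-disjoint c

  splice-after : ∀ α p β {t is} → IsPath G (through α p β) →
    Unique (t ∷ is) → proj₁ p ≡ nb t →
    Connected (Adj G') (last (map new (t ∷ is))) (head (map old β)) →
    IsPath G' (spliced α p (t ∷ is) β)
  splice-after α p β {t} {is} path u p≡nb c with IsPath-++⁻ G (map proj₁ α) path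
  ... | pα , ppvβ , dis , α→p with IsPath-∷⁻ G ppvβ
  ... | p∉vβ , pvβ = IsPath-++⁺ G' (lift-path pα)
        (IsPath-∷⁺ G' p∉ (just (old~new⇐ {p} t p≡nb)) (splice-at-start β pvβ u c))
        dis′ (lift-last α α→p)
    where
    p∉ : old p ∉ map new (t ∷ is) ++ map old β
    p∉ m with ∈-++⁻ (map new (t ∷ is)) m
    ... | inj₁ m′ = old∉new m′
    ... | inj₂ m′ = p∉vβ (there (old-∈⁻ m′))
    dis′ : Disjoint (map old α) (old p ∷ map new (t ∷ is) ++ map old β)
    dis′ (m₁ , m₂) with ∈-map⁻ old m₁
    ... | x , x∈α , refl with m₂
    ...   | here refl = dis (∈-map⁺ proj₁ x∈α , here refl)
    ...   | there m₂′ with ∈-++⁻ (map new (t ∷ is)) m₂′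
    ...     | inj₁ m = old∉new m
    ...     | inj₂ m = dis (∈-map⁺ proj₁ x∈α , there (there (old-∈⁻ m)))

  splice-at-start-covers : ∀ β is → (∀ x → x ∈ v ∷ map proj₁ β) →
                           ∀ x → old x ∈ map new is ++ map old β
  splice-at-start-covers β is covers x with covers (proj₁ x)
  ... | here x≡v = ⊥-elim (Old≢v x x≡v)
  ... | there m  = ∈-++⁺ʳ (map new is) (old-∈⁺ m)

  splice-after-covers : ∀ α p β is → (∀ x → x ∈ through α p β) →
                        ∀ x → old x ∈ spliced α p is β
  splice-after-covers α p β is covers x with ∈-++⁻ (map proj₁ α) (covers (proj₁ x))
  ... | inj₁ m                 = ∈-++⁺ˡ (old-∈⁺ m)
  ... | inj₂ (here x≡p)         = ∈-++⁺ʳ (map old α) (here (cong old (Old-≡ x≡p)))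
  ... | inj₂ (there (here x≡v)) = ⊥-elim (Old≢v x x≡v)
  ... | inj₂ (there (there m))  = ∈-++⁺ʳ (map old α) (there (∈-++⁺ʳ (map new is) (old-∈⁺ m)))

  -- Hamilton paths of the blow-up

  ham-splice-with : ∀ (α : List Old) (p : Old) (β : List Old) {t j} →
    IsHamPath G (through α p β) →
    proj₁ p ≡ nb t → t ≢ j → Connected (Adj G') (just (new j)) (head (map old β)) →
    IsHamPath G' (spliced α p (triangle t j) β)
  ham-splice-with α p β {t} {j} (path , covers) p≡nb t≢j c =
    splice-after α p β path (triangle-unique t≢j) p≡nb c , λ
      { (inj₁ x) → splice-after-covers α p β (triangle t j) covers x
      ; (inj₂ k) → ∈-++⁺ʳ (map old α) (there (∈-++⁺ˡ (∈-map⁺ new (triangle-covers t≢j k)))) }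

  entry-index : ∀ (α : List Old) (p : Old) (β : List Old) →
                IsPath G (through α p β) → ∃ λ t → proj₁ p ≡ nb t
  entry-index α p β path with IsPath-++⁻ G (map proj₁ α) path
  ... | _ , (_ , p~v ∷ _) , _ = nb-index (symAdj G p~v)

  crossing-indices : ∀ (α : List Old) (p y : Old) (β : List Old) →
    IsPath G (through α p (y ∷ β)) →
    ∃₂ λ t j → proj₁ p ≡ nb t × proj₁ y ≡ nb j × t ≢ j
  crossing-indices α p y β path with IsPath-++⁻ G (map proj₁ α) path
  ... | _ , ((_ ∷ p≢y ∷ _) ∷ _ , p~v ∷ v~y ∷ _) , _
    with nb-index (symAdj G p~v) | nb-index v~y
  ... | t , p≡nb | j , y≡nb = t , j , p≡nb , y≡nb , λ { refl → p≢y (trans p≡nb (sym y≡nb)) }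

  ham-splice : ∀ (α : List Old) (p : Old) (β : List Old) →
    IsHamPath G (through α p β) →
    ∃₂ λ t is → IsHamPath G' (spliced α p (t ∷ is) β)
  ham-splice α p [] ham with entry-index α p [] (proj₁ ham)
  ... | t , p≡nb = t , _ ∷ _ ∷ [] , ham-splice-with α p [] ham p≡nb (other-≢ t) just-nothing
  ham-splice α p (y ∷ β) ham with crossing-indices α p y β (proj₁ ham)
  ... | t , j , p≡nb , y≡nb , t≢j =
    t , _ ∷ _ ∷ [] , ham-splice-with α p (y ∷ β) ham p≡nb t≢j (just (new~old⇐ {y} j y≡nb))

  split-at-v : ∀ {x₀ xs} → IsPath G (x₀ ∷ xs) → v ∈ xs →
    ∃₂ λ (α : List Old) (p : Old) → ∃ λ β → x₀ ∷ xs ≡ through α p β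
  split-at-v {x₀} {xs} path v∈xs with split-at-predecessor x₀ xs v∈xs
  ... | α , p , β , eq with Unique-++⁻ α (subst Unique eq (proj₁ path))
  ... | _ , (p∉ ∷ v∉β ∷ _) , dis
    with v∉⇒Olds α (λ v∈α → dis (v∈α , there (here refl))) | v∉⇒Olds β (All.All¬⇒¬Any v∉β)
  ... | α′ , refl | β′ , refl = α′ , toOld (All.head p∉) , β′ , eq

  spliced-second-vertex : ∀ (α : List Old) (p : Old) (β : List Old) t is {x w r} →
    proj₁ x ∷ w ∷ r ≡ through α p β →
    ∃₂ λ s r′ → spliced α p (t ∷ is) β ≡ old x ∷ s ∷ r′ × down s ≡ w
  spliced-second-vertex [] p β t is eq with ∷-injective eq
  ... | x≡p , eq′ = new t , _ , cong (λ y → spliced [] y (t ∷ is) β) (sym (Old-≡ x≡p)) ,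
                    sym (∷-injectiveˡ eq′)
  spliced-second-vertex (a ∷ []) p β t is eq with ∷-injective eq
  ... | x≡a , eq′ = old p , _ , cong (λ y → spliced [ y ] p (t ∷ is) β) (sym (Old-≡ x≡a)) ,
                    sym (∷-injectiveˡ eq′)
  spliced-second-vertex (a ∷ b ∷ α) p β t is eq with ∷-injective eq
  ... | x≡a , eq′ = old b , _ , cong (λ y → spliced (y ∷ b ∷ α) p (t ∷ is) β) (sym (Old-≡ x≡a)) ,
                    sym (∷-injectiveˡ eq′)

  lift-ham-from-old : ∀ (x : Old) w r → IsHamPath G (proj₁ x ∷ w ∷ r) →
    ∃₂ λ s r′ → IsHamPath G' (old x ∷ s ∷ r′) × down s ≡ w
  lift-ham-from-old x w r ham@(path , covers) with covers v
  ... | here v≡x = ⊥-elim (Old≢v x (sym v≡x))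
  ... | there v∈ with split-at-v path v∈
  ...   | α , p , β , eq with ham-splice α p β (subst (IsHamPath G) eq ham)
  ...     | t , is , ham′ with spliced-second-vertex α p β t is eq
  ...       | s , r′ , eq′ , down≡ = s , r′ , subst (IsHamPath G') eq′ ham′ , down≡

  ham-from-new-via-new : ∀ e w r → w ≢ nb e → IsHamPath G (v ∷ w ∷ r) →
    ∃₂ λ k r′ → IsHamPath G' (new e ∷ new k ∷ r′)
  ham-from-new-via-new e w r w≢nb (path , covers) with v∉⇒Olds (w ∷ r) (proj₁ (IsPath-∷⁻ G path))
  ... | y ∷ β , refl with nb-index (Linked.head (proj₂ path))
  ... | j , y≡nb = third e j , _ ,
    splice-at-start (y ∷ β) path (triangle-unique e≢j) (just (new~old⇐ {y} j y≡nb)) ,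
    λ { (inj₁ x) → splice-at-start-covers (y ∷ β) (triangle e j) covers x
      ; (inj₂ k) → ∈-++⁺ˡ (∈-map⁺ new (triangle-covers e≢j k)) }
    where
    e≢j : e ≢ j
    e≢j refl = w≢nb y≡nb

  ham-from-new-via-old : ∀ e u r → u ≢ v → IsHamPath G (nb e ∷ u ∷ r) →
    ∃₂ λ (x : Old) r′ → IsHamPath G' (new e ∷ old x ∷ r′)
  ham-from-new-via-old e u r u≢v ham@(path , covers) with covers v
  ... | here v≡nb = ⊥-elim (irrAdj G (subst (Adj G v) (sym v≡nb) (v~nb e)))
  ... | there v∈ with split-at-v path v∈
  ...   | [] , p , β , eq = ⊥-elim (u≢v (∷-injectiveˡ (proj₂ (∷-injective eq))))
  ...   | q ∷ α , p , β , eq with subst (IsHamPath G) eq ham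
  ...     | ham′@(path′ , covers′) with entry-index (q ∷ α) p β path′
  ...       | i , p≡nb = q , _ ,
    IsPath-∷⁺ G' e∉ (just (new~old⇐ {q} e (sym (∷-injectiveˡ eq))))
      (splice-after (q ∷ α) p β path′ ((≢-sym k≢i ∷ []) ∷ [] ∷ []) p≡nb (exit β path′)) ,
    covers″
    where
    q≢p : proj₁ q ≢ proj₁ p
    q≢p = Unique-++⇒≢ (map proj₁ (q ∷ α)) (proj₁ path′) (here refl) (here refl)
    e≢i : e ≢ i
    e≢i refl = q≢p (trans (sym (∷-injectiveˡ eq)) (sym p≡nb))
    k = third e i
    k≢e : k ≢ e
    k≢e = proj₁ (third-≢ e i e≢i)
    k≢i : k ≢ i
    k≢i = proj₂ (third-≢ e i e≢i)
    exit : ∀ β′ → IsPath G (through (q ∷ α) p β′) →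
           Connected (Adj G') (just (new k)) (head (map old β′))
    exit [] _ = just-nothing
    exit (y ∷ β′) path″ with IsPath-++⁻ G (map proj₁ (q ∷ α)) path″
    ... | _ , ((_ ∷ p≢y ∷ _) ∷ _ , _ ∷ v~y ∷ _) , dis , _ with nb-index v~y
    ... | j , y≡nb = just (new~old⇐ {y} k (trans y≡nb (cong nb j≡k)))
      where
      j≡k : j ≡ k
      j≡k = third-unique e i j e≢i
        (λ { refl → dis (here (trans y≡nb (∷-injectiveˡ eq)) , there (there (here refl))) })
        (λ { refl → p≢y (trans p≡nb (sym y≡nb)) })
    e∉ : new e ∉ spliced (q ∷ α) p (i ∷ k ∷ []) β
    e∉ m with ∈-++⁻ (map old (q ∷ α)) m
    ... | inj₁ m′ = new∉old m′
    ... | inj₂ (there (here e≡i)) = e≢i (inj₂-injective e≡i)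
    ... | inj₂ (there (there (here e≡k))) = k≢e (sym (inj₂-injective e≡k))
    ... | inj₂ (there (there (there m′))) = new∉old m′
    covers″ : ∀ z → z ∈ new e ∷ spliced (q ∷ α) p (i ∷ k ∷ []) β
    covers″ (inj₁ x) = there (splice-after-covers (q ∷ α) p β (i ∷ k ∷ []) covers′ x)
    covers″ (inj₂ l) with l Fin.≟ e | l Fin.≟ i
    ... | yes refl | _        = here refl
    ... | no _     | yes refl = there (∈-++⁺ʳ (map old (q ∷ α)) (there (here refl)))
    ... | no l≢e   | no l≢i   = there (∈-++⁺ʳ (map old (q ∷ α))
                                  (there (there (here (cong new (third-unique e i l e≢i l≢e l≢i))))))

  blowUp-DoublyHomTraceable : DoublyHomTraceable G → DoublyHomTraceable G'
  blowUp-DoublyHomTraceable dht (inj₁ x) with dht (proj₁ x)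
  ... | w₁ , w₂ , r₁ , r₂ , w₁≢w₂ , ham₁ , ham₂
    with lift-ham-from-old x w₁ r₁ ham₁ | lift-ham-from-old x w₂ r₂ ham₂
  ... | s₁ , r₁′ , ham₁′ , s₁↓ | s₂ , r₂′ , ham₂′ , s₂↓ =
    s₁ , s₂ , r₁′ , r₂′ , (λ s₁≡s₂ → w₁≢w₂ (trans (sym s₁↓) (trans (cong down s₁≡s₂) s₂↓))) ,
    ham₁′ , ham₂′
  blowUp-DoublyHomTraceable dht (inj₂ e)
    with ham-path-avoiding G dht v (nb e) | ham-path-avoiding G dht (nb e) v
  ... | w , r , w≢nb , ham₁ | u , r′ , u≢v , ham₂
    with ham-from-new-via-new e w r w≢nb ham₁ | ham-from-new-via-old e u r′ u≢v ham₂
  ... | k , r₁ , ham₁′ | x , r₂ , ham₂′ = new k , old x , r₁ , r₂ , (λ ()) , ham₁′ , ham₂′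

  -- Cycles of the blow-up

  lift-cycle-through-v : ∀ {xs} → IsCycle G xs → v ∈ xs →
                         ∃ λ ys → IsCycle G' ys × length ys ≡ length xs + 2
  lift-cycle-through-v {xs} cyc v∈xs with rotate-around G cyc v∈xs
  ... | p , y , γ , (_ , path , closes) , len with IsPath-∷⁻ G path
  ... | p∉ , pathᵥ
    with v∉⇒Olds (p ∷ y ∷ γ)
           (λ { (here v≡p) → p∉ (here (sym v≡p)) ; (there v∈) → proj₁ (IsPath-∷⁻ G pathᵥ) v∈ })
  ... | p′ ∷ y′ ∷ γ′ , refl with crossing-indices [] p′ y′ γ′ path
  ... | t , j , p≡nb , y≡nb , t≢j =
    old p′ ∷ map new (triangle t j) ++ map old (y′ ∷ γ′) ,
    (s≤s (s≤s (s≤s z≤n)) ,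
     splice-after [] p′ (y′ ∷ γ′) path (triangle-unique t≢j) p≡nb (just (new~old⇐ {y′} j y≡nb)) ,
     Connected⇒Closes G' (old p′) (map new (triangle t j) ++ map old (y′ ∷ γ′))
       (lift-last (y′ ∷ γ′) (Closes⇒Connected G (proj₁ p′) (v ∷ map proj₁ (y′ ∷ γ′)) closes))) ,
    length≡
    where
    length≡ : 5 + length (map old γ′) ≡ length xs + 2
    length≡ = begin
      5 + length (map old γ′)          ≡⟨ cong (5 +_) (length-lift γ′) ⟩
      2 + (3 + length (map proj₁ γ′)) ≡⟨ cong (2 +_) (sym len) ⟩
      2 + length xs               ≡⟨ +-comm 2 (length xs) ⟩
      length xs + 2               ∎
      where open ≡-Reasoning

  contract-cycle : ∀ {xs} → IsCycle G' (map old xs) → IsCycle G (map proj₁ xs)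
  contract-cycle {x ∷ xs} (3≤ , path , closes) =
    subst (3 ≤_) (length-lift (x ∷ xs)) 3≤ ,
    contract-path path ,
    Connected⇒Closes G (proj₁ x) (map proj₁ xs)
      (contract-last (x ∷ xs) (Closes⇒Connected G' (old x) (map old xs) closes))

  new-run-exit : ∀ i μ {x} → Connected (Adj G') (last (new i ∷ map new μ)) (just (old x)) →
                 Adj G v (proj₁ x)
  new-run-exit i []      {x} (just i~x) =
    symAdj G (contract-edge {x} (new i) (symAdj G' {new i} {old x} i~x))
  new-run-exit i (j ∷ μ)     c          = new-run-exit j μ c

  contract-block : ∀ i μ x y xs →
    IsCycle G' (new i ∷ map new μ ++ map old (x ∷ y ∷ xs)) → IsCycle G (v ∷ map proj₁ (x ∷ y ∷ xs))
  contract-block i μ x y xs (_ , path , closes) with IsPath-++⁻ G' (new i ∷ map new μ) path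
  ... | _ , pathₒ , _ , run→x =
    s≤s (s≤s (s≤s z≤n)) ,
    IsPath-∷⁺ G (v∉Olds (x ∷ y ∷ xs))
      (just (new-run-exit i μ run→x)) (contract-path pathₒ) ,
    Connected⇒Closes G v (map proj₁ (x ∷ y ∷ xs)) (contract-last (x ∷ y ∷ xs)
      (subst (λ l → Connected (Adj G') l (just (new i))) (last-++ (new i ∷ map new μ))
        (Closes⇒Connected G' (new i) (map new μ ++ map old (x ∷ y ∷ xs)) closes)))

  isolated-new-impossible : ∀ α x k y (β : List (V G')) → ¬ IsPath G' (α ++ old x ∷ new k ∷ old y ∷ β)
  isolated-new-impossible α x k y β path with IsPath-++⁻ G' α path
  ... | _ , ((_ ∷ x≢y ∷ _) ∷ _ , x~k ∷ k~y ∷ _) , _ =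
    x≢y (cong old (new-has-one-old-neighbour {x} {y} k x~k k~y))

  two-new-runs-impossible : ∀ i j α β k l γ → ¬ Unique ((new i ∷ new j ∷ α) ++ β ++ new k ∷ new l ∷ γ)
  two-new-runs-impossible i j α β k l γ u with Unique-++⁻ (new i ∷ new j ∷ α) u
  ... | ((i≢j ∷ _) ∷ _) , u₂ , _ with Unique-++⁻ β u₂
  ... | _ , ((k≢l ∷ _) ∷ _) , _ =
    four-not-unique i j k l (Unique.map⁻ {f = new}
      ((i≢j ∷ ≢ (here refl) (here refl) ∷ ≢ (here refl) (there (here refl)) ∷ []) ∷
       (≢ (there (here refl)) (here refl) ∷ ≢ (there (here refl)) (there (here refl)) ∷ []) ∷
       (k≢l ∷ []) ∷ [] ∷ []))
    where
    ≢ : ∀ {s t} → s ∈ new i ∷ new j ∷ α → t ∈ new k ∷ new l ∷ γ → s ≢ t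
    ≢ s∈ t∈ = Unique-++⇒≢ (new i ∷ new j ∷ α) u s∈ (∈-++⁺ʳ β t∈)

  second-new-run-impossible : ∀ i j μ π p k κ o →
    ¬ IsCycle G' (new i ∷ (new j ∷ map new μ ++ π ++ old p ∷ new k ∷ κ) ++ [ old o ])
  second-new-run-impossible i j μ π p k κ o (_ , path , _) =
    after-run κ (subst (IsPath G') reassoc path)
    where
    A = new j ∷ map new μ
    reassoc : new i ∷ (A ++ π ++ old p ∷ new k ∷ κ) ++ [ old o ] ≡
              (new i ∷ A ++ π) ++ old p ∷ new k ∷ κ ++ [ old o ]
    reassoc = cong (new i ∷_) (begin
      (A ++ π ++ old p ∷ new k ∷ κ) ++ [ old o ]  ≡⟨ ++-assoc A (π ++ old p ∷ new k ∷ κ) [ old o ] ⟩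
      A ++ (π ++ old p ∷ new k ∷ κ) ++ [ old o ]  ≡⟨ cong (A ++_) (++-assoc π (old p ∷ new k ∷ κ) [ old o ]) ⟩
      A ++ π ++ old p ∷ new k ∷ κ ++ [ old o ]    ≡⟨ ++-assoc A π _ ⟨
      (A ++ π) ++ old p ∷ new k ∷ κ ++ [ old o ]  ∎)
      where open ≡-Reasoning
    after-run : ∀ κ → ¬ IsPath G' ((new i ∷ A ++ π) ++ old p ∷ new k ∷ κ ++ [ old o ])
    after-run []          = isolated-new-impossible (new i ∷ A ++ π) p k o []
    after-run (inj₁ q ∷ κ) = isolated-new-impossible (new i ∷ A ++ π) p k q (κ ++ [ old o ])
    after-run (inj₂ l ∷ κ) =
      two-new-runs-impossible i j (map new μ ++ π) [ old p ] k l (κ ++ [ old o ]) ∘ proj₁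

  -- A new vertex has a single old neighbour, so a run of new vertices between old ones
  -- has at least two vertices, and the three new vertices leave no room for a second run.
  old-after-new-run : ∀ i μ zs o → IsCycle G' (new i ∷ (map new μ ++ zs) ++ [ old o ]) →
                      Maybe.All IsOld (head zs) → All IsOld zs
  old-after-new-run i μ zs o cyc head-old with all-or-any old-or-new zs
  ... | inj₁ all-old = all-old
  ... | inj₂ any-new with zs | head-old | any-new | μ
  ...   | _ ∷ _  | Maybe.just (_ , refl) | here (_ , ())    | _
  ...   | _ ∷ zs | Maybe.just (x , refl) | there _         | [] =
    ⊥-elim (isolated-new-impossible [] o i x zs
      (proj₁ (proj₂ (rotate-cycle G' (new i ∷ old x ∷ zs) [ old o ] cyc))))
  ...   | _ ∷ zs | Maybe.just (x , refl) | there any-new′  | j ∷ μ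
    with first-transition old-or-new zs (x , refl) any-new′
  ... | π , _ , _ , κ , eq , (p , refl) , (k , refl) =
    ⊥-elim (second-new-run-impossible i j μ π p k κ o
      (subst (λ l → IsCycle G' (new i ∷ (new j ∷ map new μ ++ l) ++ [ old o ])) eq cyc))

  module _ (c : ℕ) (3≤c : 3 ≤ c) (longest : ∀ xs → IsCycle G xs → length xs ≤ c) where

    block-length : ∀ i μ xs → IsCycle G' (new i ∷ map new μ ++ map old xs) →
                   length (new i ∷ map new μ ++ map old xs) ≤ c + 2
    block-length i μ xs cyc@(_ , (u , _) , _) =
      subst (_≤ c + 2) (sym (length-++ (new i ∷ map new μ))) (by-tail-length xs cyc)
      where
      n = length (new i ∷ map new μ)
      run≤3 : n ≤ 3
      run≤3 = subst (_≤ 3) (sym (length-map new (i ∷ μ)))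
                (Unique⇒length≤3 (Unique.map⁻ (proj₁ (Unique-++⁻ (new i ∷ map new μ) u))))
      open ≤-Reasoning
      by-tail-length : ∀ xs → IsCycle G' (new i ∷ map new μ ++ map old xs) →
                       n + length (map old xs) ≤ c + 2
      by-tail-length [] _ = begin
        n + 0  ≡⟨ +-identityʳ n ⟩
        n      ≤⟨ run≤3 ⟩
        3      ≤⟨ 3≤c ⟩
        c      ≤⟨ m≤m+n c 2 ⟩
        c + 2  ∎
      by-tail-length (_ ∷ []) _ = begin
        n + 1  ≤⟨ +-monoˡ-≤ 1 run≤3 ⟩
        4      ≤⟨ n≤1+n 4 ⟩
        3 + 2  ≤⟨ +-monoˡ-≤ 2 3≤c ⟩
        c + 2  ∎
      by-tail-length (x ∷ y ∷ xs) cyc = begin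
        n + m      ≤⟨ +-monoˡ-≤ m run≤3 ⟩
        2 + suc m  ≤⟨ +-monoʳ-≤ 2 (subst (_≤ c) (cong suc (sym (length-lift L)))
                                   (longest _ (contract-block i μ x y xs cyc))) ⟩
        2 + c      ≡⟨ +-comm 2 c ⟩
        c + 2      ∎
        where
        L = x ∷ y ∷ xs
        m = length (map old L)

    boundary-length : ∀ i D o → IsCycle G' (new i ∷ D ++ [ old o ]) →
                      length (new i ∷ D ++ [ old o ]) ≤ c + 2
    boundary-length i D o cyc with span (swap ∘ old-or-new) D
    ... | ys , zs , refl , all-new , head-old with All-image⇒map all-new
    ... | μ , refl with All-image⇒map (old-after-new-run i μ zs o cyc head-old)
    ... | ω , refl = subst (λ l → length (new i ∷ l) ≤ c + 2) (sym reshape)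
                       (block-length i μ (ω ∷ʳ o) (subst (λ l → IsCycle G' (new i ∷ l)) reshape cyc))
      where
      reshape : (map new μ ++ map old ω) ++ [ old o ] ≡ map new μ ++ map old (ω ∷ʳ o)
      reshape = trans (++-assoc (map new μ) (map old ω) [ old o ])
                      (cong (map new μ ++_) (sym (map-++ old ω [ o ])))

    all-new-length : ∀ μ → IsCycle G' (map new μ) → length (map new μ) ≤ c + 2
    all-new-length μ (_ , (u , _) , _) = begin
      length (map new μ)  ≡⟨ length-map new μ ⟩
      length μ            ≤⟨ Unique⇒length≤3 (Unique.map⁻ u) ⟩
      3                   ≤⟨ 3≤c ⟩
      c                   ≤⟨ m≤m+n c 2 ⟩
      c + 2               ∎
      where open ≤-Reasoning

    all-old-length : ∀ ω → IsCycle G' (map old ω) → length (map old ω) ≤ c + 2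
    all-old-length ω cyc = begin
      length (map old ω)     ≡⟨ length-lift ω ⟩
      length (map proj₁ ω)   ≤⟨ longest _ (contract-cycle cyc) ⟩
      c                      ≤⟨ m≤m+n c 2 ⟩
      c + 2                  ∎
      where open ≤-Reasoning

    from-old-length : ∀ o ys → IsCycle G' (old o ∷ ys) → length (old o ∷ ys) ≤ c + 2
    from-old-length o ys cyc with all-or-any old-or-new ys
    ... | inj₁ all-old with All-image⇒map all-old
    ...   | ω , refl = all-old-length (o ∷ ω) cyc
    from-old-length o ys cyc | inj₂ any-new with first-transition old-or-new ys (o , refl) any-new
    ... | π , _ , _ , κ , eq , (p , refl) , (k , refl) =
      subst (_≤ c + 2) (trans (length-rotate-cut G' π (old p) (new k) κ) (cong length (sym eq)))
        (boundary-length k (κ ++ π) p (rotate-cut G' π (old p) (new k) κ (subst (IsCycle G') eq cyc)))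

    blowUp-cycle-length : ∀ C → IsCycle G' C → length C ≤ c + 2
    blowUp-cycle-length C cyc with all-or-any (swap ∘ old-or-new) C
    ... | inj₁ all-new with All-image⇒map all-new
    ...   | μ , refl = all-new-length μ cyc
    blowUp-cycle-length C cyc | inj₂ any-old with find any-old
    ... | _ , s∈C , (o , refl) with rotate-to-front G' cyc s∈C
    ... | ys , cyc′ , len = subst (_≤ c + 2) (sym len) (from-old-length o ys cyc′)

  blowUp-circumference : ∀ c → IsCircumference G c → OnLongestCycle G c v →
                         IsCircumference G' (c + 2)
  blowUp-circumference c (_ , longest) (xs , cyc@(3≤ , _) , len , v∈xs)
    with lift-cycle-through-v cyc v∈xs
  ... | ys , cyc′ , len′ =
    (ys , cyc′ , trans len′ (cong (_+ 2) len)) , blowUp-cycle-length c (subst (3 ≤_) len 3≤) longest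

lemma1 : (G : Graph) (n : ℕ) → (V G ↔ Fin n) → (c : ℕ) → IsCircumference G c →
    DoublyHomTraceable G → (v a b d : V G) → Degree3Nbhd G v a b d →
    DoublyHomTraceable (blowUp G v a b d)
      × (OnLongestCycle G c v → IsCircumference (blowUp G v a b d) (c + 2))
lemma1 G _ _ c circ dht v a b d (_ , _ , _ , v~a , v~b , v~d , N[v]) =
  blowUp-DoublyHomTraceable dht , blowUp-circumference c circ
  where open BlowUp G v a b d v~a v~b v~d N[v]
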